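{- Let $\mathcal T$ be the top tree of a rooted ordered labeled tree $T$ produced by the greedy construction. Let $z$ be an internal node of $T$ with leftmost child $z_1$, let $L_z$ be the leaf of $\mathcal T$ corresponding to the edge $(z,z_1)$, let $U$ be the smallest cluster of $\mathcal T$ containing all nodes of $T(z)$, and let $P_z$ be the path in $\mathcal T$ from $U$ to $L_z$. Let $C$ be an off-path cluster of $P_z$, i.e., a node of $\mathcal T$ not on $P_z$ whose parent is on $P_z$. Then either $E(C)\subseteq E(T(z))$ or $E(C)\cap E(T(z))=\emptyset$, where $E(X)$ denotes the set of edges of $T$ in $X$.
   Context: A labeled tree $T$ is a rooted, ordered tree each of whose nodes carries a label; $p(v)$ denotes the parent of $v$. Clusters. For a node $v$ with children $v_1,\dots,v_k$ (left to right), $T(v)$ is the subtree consisting of $v$ and its descendants, $F(v)$ the forest of proper descendants of $v$, and for $1\le s\le r\le k$, $T(v,v_s,v_r)$ is the tree pattern induced by $\{v\}\cup T(v_s)\cup\dots\cup T(v_r)$. A cluster with top boundary node $v$ is either a pattern $T(v,v_s,v_r)$ (no bottom boundary node) or a pattern $T(v,v_s,v_r)\setminus F(u)$ for a node $u$ of $T(v_s)\cup\dots\cup T(v_r)$ ($u$ is its bottom boundary node). A single edge $(v,p(v))$ is a cluster with top boundary $p(v)$, and with bottom boundary $v$ unless $v$ is a leaf of $T$. Two edge-disjoint clusters $A,B$ sharing one boundary node can be merged into $C=A\cup B$ (when $C$ is a cluster) in five ways: vertical merges, where the bottom boundary node of $A$ is the top boundary node of $B$ and $B$ contains all children of this node (allowed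 only if this node is a boundary node of no cluster other than $A,B$): type (a) if $B$ has a bottom boundary node, type (b) if not; horizontal merges, where $A,B$ have the same top boundary node, $A$ left of $B$, and at least one of them has no bottom boundary node: type (c) if only $A$ has a bottom boundary node, (d) if only $B$ has one, (e) if neither has one. $A$ is always the cluster first visited in a preorder traversal of $T$. Top tree. A top tree of $T$ is an ordered rooted binary labeled tree whose nodes correspond to clusters: the root to $T$, the leaves to the edges of $T$ (labeled by the pair (label of parent endpoint, label of child endpoint)), and each internal node to the merge of its left child's cluster $A$ and right child's cluster $B$, labeled by the merge type (a)–(e). Nodes of the top tree are identified with their clusters. Greedy construction. Maintain an auxiliary rooted ordered tree $\tilde T$, initially $T$, whose edges correspond to the current roots of the partial top tree (initially the edges of $T$). Merging edges $(u,v),(v,w)$ of $\tilde T$ creates a new top tree node whose children are the two corresponding clusters; if $v$ is the parent of $u$ and the only child of $w$ (vertical merge) the two edges are replaced by $(u,w)$; if $v$ is the parent of both $u,w$ and one of $u,w$ is a leaf (horizontal merge) they are replaced by a single edge from $v$ to one of $u,w$ (the non-leaf one, if any). While $\tilde T$ has more than one edge, do an iteration: Step 1 (horizontal): for each node $v$ of $\tilde T$ with children $v_1,\dots,v_k$, $k\ge 2$, for $i=1,\dots,\lfloor k/2\rfloor$ merge $(v,v_{2i-1}),(v,v_{2i})$ if $v_{2i-1}$ or $v_{2i}$ is a leaf; if $k$ is odd, $v_k$ is a leaf and $v_{k-2},v_{k-1}$ are non-leaves, also merge $(v,v_{k-1}),(v,v_k)$. Step 2 (vertical): for each maximal path $v_1,\dots,v_p$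 with $v_{i+1}$ the parent of $v_i$ and $v_2,\dots,v_{p-1}$ each having exactly one child, with $e_i=(v_i,v_{i+1})$: if $p$ is even merge $\{e_1,e_2\},\{e_3,e_4\},\dots,\{e_{p-3},e_{p-2}\}$; if $p$ is odd merge $\{e_1,e_2\},\dots,\{e_{p-4},e_{p-3}\}$ and also $\{e_{p-2},e_{p-1}\}$ if $e_{p-1}$ was not merged in Step 1. -}

module Defs where

open import Data.Nat using (ℕ; zero; suc)
open import Data.Bool using (Bool; true; false; if_then_else_)
open import Data.List using (List; []; _∷_; _++_; [_])
open import Data.Maybe using (Maybe; just; nothing)
open import Data.Product using (Σ; ∃; ∃-syntax; _×_; _,_)
open import Data.Sum using (_⊎_)
open import Relation.Binary.PropositionalEquality using (_≡_)
open import Relation.Nullary using (¬_)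

-- A node of T is identified by its
-- position: the list of child indices (0 = leftmost) on the path from
-- the root.  The i-th child of the node at position p is at  p ++ [ i ].

data Tree (A : Set) : Set where
  node : A → List (Tree A) → Tree A

Pos : Set
Pos = List ℕ

label : {A : Set} → Tree A → A
label (node l _) = l

mutual
  subtreeAt : {A : Set} → Tree A → Pos → Maybe (Tree A)
  subtreeAt t [] = just t
  subtreeAt (node _ ts) (i ∷ p) = subtreeAtList ts i p

  subtreeAtList : {A : Set} → List (Tree A) → ℕ → Pos → Maybe (Tree A)
  subtreeAtList [] _ _ = nothing
  subtreeAtList (t ∷ ts) zero p = subtreeAt t p
  subtreeAtList (t ∷ ts) (suc i) p = subtreeAtList ts i p

IsNode : {A : Set} → Tree A → Pos → Set
IsNode T x = ∃[ t ] (subtreeAt T x ≡ just t)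

Prefix : Pos → Pos → Set
Prefix x y = ∃[ s ] (x ++ s ≡ y)

StrictPrefix : Pos → Pos → Set
StrictPrefix x y = ∃[ i ] ∃[ s ] (x ++ (i ∷ s) ≡ y)

-- A leaf corresponds to an edge (p(v), v) of T; it carries
-- the pair of labels (label of p(v), label of v) and, to identify the
-- edge, the position of its child endpoint v.  An internal node carries
-- the merge type (a)-(e); its left child is the cluster A, its right
-- child the cluster B.

data MergeType : Set where
  typeA typeB typeC typeD typeE : MergeType

data TopTree (A : Set) : Set where
  leaf  : A → A → Pos → TopTree A
  merge : MergeType → TopTree A → TopTree A → TopTree A

EdgeIn : {A : Set} → TopTree A → Pos → Set
EdgeIn (leaf _ _ q) q' = q ≡ q'
EdgeIn (merge _ l r) q = EdgeIn l q ⊎ EdgeIn r q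

NodeIn : {A : Set} → TopTree A → Pos → Set
NodeIn (leaf _ _ q) x = (x ≡ q) ⊎ (∃[ i ] (x ++ [ i ] ≡ q))
NodeIn (merge _ l r) x = NodeIn l x ⊎ NodeIn r x

-- positions in a top tree: false = left child, true = right child
TPos : Set
TPos = List Bool

subAt : {A : Set} → TopTree A → TPos → Maybe (TopTree A)
subAt C [] = just C
subAt (leaf _ _ _) (_ ∷ _) = nothing
subAt (merge _ l r) (false ∷ p) = subAt l p
subAt (merge _ l r) (true ∷ p) = subAt r p

-- The auxiliary tree T~ : each edge (to a child) carries the cluster
-- (current root of the partial top tree) it corresponds to, and a flag
-- recording whether it was produced by a merge in Step 1 of the current
-- iteration.

data Aux (A : Set) : Set
data Kids (A : Set) : Set

data Aux A where
  anode : Kids A → Aux A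

data Kids A where
  none : Kids A
  kid  : TopTree A → Bool → Aux A → Kids A → Kids A

isLeaf : {A : Set} → Aux A → Bool
isLeaf (anode none) = true
isLeaf (anode (kid _ _ _ _)) = false

mutual
  toAux : {A : Set} → Pos → Tree A → Aux A
  toAux p (node l ts) = anode (toKids p l 0 ts)

  toKids : {A : Set} → Pos → A → ℕ → List (Tree A) → Kids A
  toKids p l i [] = none
  toKids p l i (t ∷ ts) =
    kid (leaf l (label t) (p ++ [ i ])) false (toAux (p ++ [ i ]) t) (toKids p l (suc i) ts)

-- try to merge the sibling edges (v,u) [cluster c1, subtree t1] and
-- (v,w) [cluster c2, subtree t2], u left of w; prepend result to rest
hmerge : {A : Set} → TopTree A → Aux A → TopTree A → Aux A → Kids A → Kids A
hmerge c1 t1 c2 t2 rest with isLeaf t1 | isLeaf t2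
... | false | false = kid c1 false t1 (kid c2 false t2 rest)
... | false | true  = kid (merge typeC c1 c2) true t1 rest
... | true  | false = kid (merge typeD c1 c2) true t2 rest
... | true  | true  = kid (merge typeE c1 c2) true t1 rest

pairUp : {A : Set} → Kids A → Kids A
pairUp none = none
pairUp (kid c1 _ t1 none) = kid c1 false t1 none
pairUp (kid c1 _ t1 (kid c2 _ t2 none)) = hmerge c1 t1 c2 t2 none
pairUp (kid c1 _ t1 (kid c2 _ t2 (kid c3 _ t3 none))) with isLeaf t1 | isLeaf t2 | isLeaf t3
... | false | false | true  = kid c1 false t1 (hmerge c2 t2 c3 t3 none)
... | false | false | false = kid c1 false t1 (kid c2 false t2 (kid c3 false t3 none))
... | _     | _     | _     = hmerge c1 t1 c2 t2 (kid c3 false t3 none)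
pairUp (kid c1 _ t1 (kid c2 _ t2 rest@(kid _ _ _ (kid _ _ _ _)))) =
  hmerge c1 t1 c2 t2 (pairUp rest)

mutual
  step1 : {A : Set} → Aux A → Aux A
  step1 (anode ks) = anode (pairUp (step1Kids ks))

  step1Kids : {A : Set} → Kids A → Kids A
  step1Kids none = none
  step1Kids (kid c f t ks) = kid c f (step1 t) (step1Kids ks)

-- Step 2 (vertical merges) along maximal paths v_1,...,v_p, pairing
-- edges e_1=(v_1,v_2), e_2, ... from the bottom.

-- Result of processing the part of a maximal path below a node x:
--  even t'      : all edges below x are dealt with; t' is the new subtree
--                 at x; the edge above x starts a new pair.
--  odd c b t'   : the edge below x (cluster c) waits for its partner (the
--                 edge above x); t' is the new subtree at the lower
--                 endpoint y of that edge and b = (y is a leaf of T~).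
data DownRes (A : Set) : Set where
  even : Aux A → DownRes A
  odd  : TopTree A → Bool → Aux A → DownRes A

-- vertical merge type: (a) if B has a bottom boundary node, else (b)
vtype : Bool → MergeType
vtype true  = typeB
vtype false = typeA

mutual
  -- step2 x: x is the top node of all maximal paths through its child edges
  step2 : {A : Set} → Aux A → Aux A
  step2 (anode ks) = anode (step2Kids ks)

  step2Kids : {A : Set} → Kids A → Kids A
  step2Kids none = none
  step2Kids (kid c f t ks) with down t
  ... | even t' = kid c false t' (step2Kids ks)
  ... | odd c0 b t' = if f
        then kid c false (anode (kid c0 false t' none)) (step2Kids ks)
        else kid (merge (vtype b) c c0) false t' (step2Kids ks)

  down : {A : Set} → Aux A → DownRes A
  down (anode none) = even (anode none)
  down (anode (kid c f t none)) with down t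
  ... | even t' = odd c (isLeaf t) t'
  ... | odd c0 b t' = even (anode (kid (merge (vtype b) c c0) false t' none))
  down x@(anode (kid _ _ _ (kid _ _ _ _))) = even (step2 x)

-- Greedy construction, run with an explicit bound (fuel) on the number
-- of iterations; returns nothing if the bound is exhausted (or T has no
-- edge).

loop : {A : Set} → ℕ → Aux A → Maybe (TopTree A)
loop _ (anode (kid c _ (anode none) none)) = just c
loop zero _ = nothing
loop (suc n) x = loop n (step2 (step1 x))

greedy : {A : Set} → ℕ → Tree A → Maybe (TopTree A)
greedy fuel T = loop fuel (toAux [] T)

ContainsSubtree : {A : Set} → Tree A → Pos → TopTree A → Set
ContainsSubtree T z U = ∀ x → IsNode T x → Prefix z x → NodeIn U x

SmallestContaining : {A : Set} → Tree A → TopTree A → Pos → TopTree A → Set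
SmallestContaining T 𝒯 z U =
  ContainsSubtree T z U ×
  (∀ v V → subAt 𝒯 v ≡ just V → ContainsSubtree T z V → ∀ x → NodeIn U x → NodeIn V x)

LeafFor : {A : Set} → TopTree A → TPos → Pos → Set
LeafFor 𝒯 l q = ∃[ a ] ∃[ b ] (subAt 𝒯 l ≡ just (leaf a b q))

OnPath : TPos → TPos → TPos → Set
OnPath u l x = Prefix′ u x × Prefix′ x l
  where
    Prefix′ : TPos → TPos → Set
    Prefix′ p q = ∃[ s ] (p ++ s ≡ q)

OffPath : TPos → TPos → TPos → Set
OffPath u l c = (∃[ c′ ] ∃[ b ] ((c ≡ c′ ++ [ b ]) × OnPath u l c′)) × ¬ OnPath u l c

EdgesInside : {A : Set} → Tree A → Pos → TopTree A → Set
EdgesInside T z C = ∀ q → EdgeIn C q → IsNode T q × StrictPrefix z q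

EdgesDisjoint : {A : Set} → Tree A → Pos → TopTree A → Set
EdgesDisjoint T z C = ∀ q → EdgeIn C q → IsNode T q → ¬ StrictPrefix z q

module Submission where

-- Every cluster built by the greedy construction is boundary closed: if it
-- has an edge inside T(z) and one outside, it contains the edge (z, z₁).
-- Moreover the two children of every top-tree node are edge-disjoint, so
-- a cluster containing (z, z₁) is an ancestor of L_z; an off-path C is
-- not, hence it cannot straddle T(z).

open import Defs
open import Data.Nat using (ℕ; zero; suc; _+_; _≟_)
open import Data.Nat.Properties using (+-suc; +-identityʳ; m≢1+m+n)
open import Data.Bool using (Bool; true; false)
open import Data.List using (List; []; _∷_; [_]; _++_)
open import Data.List.Properties
  using (++-assoc; ++-identityʳ; ++-identityʳ-unique; ++-cancelˡ; ∷-injectiveˡ; ∷-injectiveʳ)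
open import Data.Maybe using (just)
open import Data.Product using (Σ; ∃; ∃-syntax; _×_; _,_; proj₁; proj₂)
open import Data.Sum using (_⊎_; inj₁; inj₂)
open import Data.Unit using (⊤; tt)
open import Data.Empty using (⊥; ⊥-elim)
open import Relation.Binary.PropositionalEquality using (_≡_; refl; sym; trans; cong; subst)
open import Relation.Nullary using (¬_; Dec; yes; no)

-- Positions in T

infix 4 _⊏_

_⊏_ : Pos → Pos → Set
x ⊏ y = StrictPrefix x y

⊏-trans : ∀ {x y w} → x ⊏ y → y ⊏ w → x ⊏ w
⊏-trans {x} (i , s , refl) (j , t , refl) = i , s ++ j ∷ t , sym (++-assoc x (i ∷ s) (j ∷ t))

⊏-irrefl : ∀ x → ¬ x ⊏ x
⊏-irrefl x (i , s , e) with ++-identityʳ-unique x (sym e)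
... | ()

≼-⊏-trans : ∀ {x y w} → Prefix x y → y ⊏ w → x ⊏ w
≼-⊏-trans {x} ([] , refl) (j , t , refl) = j , t , cong (_++ j ∷ t) (sym (++-identityʳ x))
≼-⊏-trans {x} (k ∷ r , refl) (j , t , refl) = k , r ++ j ∷ t , sym (++-assoc x (k ∷ r) (j ∷ t))

prefix-split : ∀ {x y} → Prefix x y → x ≡ y ⊎ x ⊏ y
prefix-split {x} ([] , e) = inj₁ (trans (sym (++-identityʳ x)) e)
prefix-split (k ∷ r , e) = inj₂ (k , r , e)

prefixes-comparable : ∀ (x y s t : Pos) → x ++ s ≡ y ++ t → Prefix x y ⊎ y ⊏ x
prefixes-comparable [] y s t e = inj₁ (y , refl)
prefixes-comparable (a ∷ x) [] s t e = inj₂ (a , x , refl)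
prefixes-comparable (a ∷ x) (b ∷ y) s t e with ∷-injectiveˡ e
... | refl with prefixes-comparable x y s t (∷-injectiveʳ e)
...   | inj₁ (r , e′) = inj₁ (r , cong (a ∷_) e′)
...   | inj₂ (i , r , e′) = inj₂ (i , r , cong (a ∷_) e′)

ancestors-comparable : ∀ {z x q} → z ⊏ q → x ⊏ q → Prefix z x ⊎ x ⊏ z
ancestors-comparable {z} {x} (i , s , e₁) (j , t , e₂) =
  prefixes-comparable z x (i ∷ s) (j ∷ t) (trans e₁ (sym e₂))

branch-injective : ∀ (x : Pos) {i j : ℕ} {s t : Pos} → x ++ i ∷ s ≡ x ++ j ∷ t → i ≡ j
branch-injective x e = ∷-injectiveˡ (++-cancelˡ x _ _ e)

child-not-below : ∀ x i s → ¬ (x ++ i ∷ s) ⊏ (x ++ [ i ])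
child-not-below x i s (j , t , e) = nonempty s (∷-injectiveʳ (++-cancelˡ x _ _ e′))
  where
  e′ : x ++ i ∷ (s ++ j ∷ t) ≡ x ++ [ i ]
  e′ = trans (sym (++-assoc x (i ∷ s) (j ∷ t))) e
  nonempty : ∀ s → ¬ s ++ j ∷ t ≡ []
  nonempty [] ()
  nonempty (_ ∷ _) ()

same-branch : ∀ {x y q j t} → x ++ j ∷ t ≡ y → y ⊏ q → ∃[ s ] (x ++ j ∷ s ≡ q)
same-branch {x} {j = j} {t} e (k , u , refl) =
  t ++ k ∷ u , trans (sym (++-assoc x (j ∷ t) (k ∷ u))) (cong (_++ k ∷ u) e)

_⊏?_ : (z q : Pos) → Dec (z ⊏ q)
[] ⊏? [] = no λ { (i , s , ()) }
[] ⊏? (i ∷ q) = yes (i , q , refl)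
(a ∷ z) ⊏? [] = no λ { (i , s , ()) }
(a ∷ z) ⊏? (b ∷ q) with a ≟ b
... | no a≢b = no λ { (i , s , e) → a≢b (∷-injectiveˡ e) }
... | yes refl with z ⊏? q
...   | yes (i , s , e) = yes (i , s , cong (a ∷_) e)
...   | no z⋢q = no λ { (i , s , e) → z⋢q (i , s , ∷-injectiveʳ e) }

_≼_ : TPos → TPos → Set
p ≼ p′ = ∃[ s ] (p ++ s ≡ p′)

-- Properties of clusters

module _ {A : Set} where

  Disjoint : TopTree A → TopTree A → Set
  Disjoint C D = ∀ q → EdgeIn C q → EdgeIn D q → ⊥

  BoundaryClosed : TopTree A → Set
  BoundaryClosed C = ∀ z q₁ q₂ → EdgeIn C q₁ → EdgeIn C q₂ → z ⊏ q₁ → ¬ z ⊏ q₂ →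
    EdgeIn C (z ++ [ 0 ])

  WellFormed : TopTree A → Set
  WellFormed (leaf _ _ _) = ⊤
  WellFormed (merge m L R) = WellFormed L × WellFormed R × Disjoint L R × BoundaryClosed (merge m L R)

  boundaryClosed : ∀ C → WellFormed C → BoundaryClosed C
  boundaryClosed (leaf _ _ q) _ z .q .q refl refl inside outside = ⊥-elim (outside inside)
  boundaryClosed (merge m L R) (_ , _ , _ , closed) = closed

  Below : Pos → TopTree A → Set
  Below x C = ∀ q → EdgeIn C q → x ⊏ q

  BranchClosed : Pos → TopTree A → Set
  BranchClosed x C = ∀ q i s → EdgeIn C q → x ++ i ∷ s ≡ q → EdgeIn C (x ++ [ i ])

  -- If z lies strictly below x and T(z) meets a branch-closed cluster P
  -- hanging from x, then P straddles z (it contains the first edge of the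
  -- branch, which is outside T(z)).
  straddle-below : ∀ {x z q P} → BranchClosed x P → BoundaryClosed P →
    EdgeIn P q → z ⊏ q → x ⊏ z → EdgeIn P (z ++ [ 0 ])
  straddle-below {x} closedP boundedP q∈P (i , s , refl) (k , r , refl) =
    boundedP _ _ (x ++ [ k ]) q∈P
      (closedP _ k (r ++ i ∷ s) q∈P (sym (++-assoc x (k ∷ r) (i ∷ s))))
      (i , s , refl) (child-not-below x k r)

  shared-branch : ∀ {x y q P Q} → x ⊏ y → BranchClosed x P → EdgeIn P y →
    BranchClosed x Q → EdgeIn Q q → y ⊏ q → ∃[ j ] (EdgeIn P (x ++ [ j ]) × EdgeIn Q (x ++ [ j ]))
  shared-branch {q = q} (j , t , e) closedP y∈P closedQ q∈Q y⊏q =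
    let s , e′ = same-branch e y⊏q
    in j , closedP _ j t y∈P e , closedQ q j s q∈Q e′

  boundaryClosed-horizontal : ∀ {x P Q} m → Below x P → BranchClosed x P → Below x Q → BranchClosed x Q →
    BoundaryClosed P → BoundaryClosed Q → BoundaryClosed (merge m P Q)
  boundaryClosed-horizontal {x} {P} {Q} m belowP closedP belowQ closedQ boundedP boundedQ = closed
    where
    across : ∀ {P Q} → Below x P → BranchClosed x P → BoundaryClosed P → Below x Q →
      ∀ z q₁ q₂ → EdgeIn P q₁ → EdgeIn Q q₂ → z ⊏ q₁ → ¬ z ⊏ q₂ → EdgeIn P (z ++ [ 0 ])
    across belowP closedP boundedP belowQ z q₁ q₂ q₁∈P q₂∈Q inside outside
      with ancestors-comparable inside (belowP q₁ q₁∈P)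
    ... | inj₁ z≼x = ⊥-elim (outside (≼-⊏-trans z≼x (belowQ q₂ q₂∈Q)))
    ... | inj₂ x⊏z = straddle-below closedP boundedP q₁∈P inside x⊏z

    closed : BoundaryClosed (merge m P Q)
    closed z q₁ q₂ (inj₁ e₁) (inj₁ e₂) inside outside = inj₁ (boundedP z q₁ q₂ e₁ e₂ inside outside)
    closed z q₁ q₂ (inj₂ e₁) (inj₂ e₂) inside outside = inj₂ (boundedQ z q₁ q₂ e₁ e₂ inside outside)
    closed z q₁ q₂ (inj₁ e₁) (inj₂ e₂) inside outside =
      inj₁ (across belowP closedP boundedP belowQ z q₁ q₂ e₁ e₂ inside outside)
    closed z q₁ q₂ (inj₂ e₁) (inj₁ e₂) inside outside =
      inj₂ (across belowQ closedQ boundedQ belowP z q₁ q₂ e₁ e₂ inside outside)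

  boundaryClosed-vertical : ∀ {y P Q} m → EdgeIn P y → Below y Q → BranchClosed y Q →
    EdgeIn Q (y ++ [ 0 ]) → BoundaryClosed P → BoundaryClosed Q → BoundaryClosed (merge m P Q)
  boundaryClosed-vertical {y} {P} {Q} m y∈P belowQ closedQ y₁∈Q boundedP boundedQ = closed
    where
    closed : BoundaryClosed (merge m P Q)
    closed z q₁ q₂ (inj₁ e₁) (inj₁ e₂) inside outside = inj₁ (boundedP z q₁ q₂ e₁ e₂ inside outside)
    closed z q₁ q₂ (inj₂ e₁) (inj₂ e₂) inside outside = inj₂ (boundedQ z q₁ q₂ e₁ e₂ inside outside)
    closed z q₁ q₂ (inj₁ e₁) (inj₂ e₂) inside outside =
      inj₁ (boundedP z q₁ y e₁ y∈P inside (λ z⊏y → outside (⊏-trans z⊏y (belowQ q₂ e₂))))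
    closed z q₁ q₂ (inj₂ e₁) (inj₁ e₂) inside outside with ancestors-comparable inside (belowQ q₁ e₁)
    ... | inj₂ y⊏z = inj₂ (straddle-below closedQ boundedQ e₁ inside y⊏z)
    ... | inj₁ z≼y with prefix-split z≼y
    ...   | inj₁ refl = inj₂ y₁∈Q
    ...   | inj₂ z⊏y = inj₁ (boundedP z y q₂ y∈P e₂ z⊏y outside)

  subcluster-edges : ∀ (𝒯 : TopTree A) p {C q} → subAt 𝒯 p ≡ just C → EdgeIn C q → EdgeIn 𝒯 q
  subcluster-edges 𝒯 [] refl e = e
  subcluster-edges (leaf _ _ _) (_ ∷ _) ()
  subcluster-edges (merge m L R) (false ∷ p) at e = inj₁ (subcluster-edges L p at e)
  subcluster-edges (merge m L R) (true ∷ p) at e = inj₂ (subcluster-edges R p at e)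

  subcluster-wellFormed : ∀ (𝒯 : TopTree A) p {C} → WellFormed 𝒯 → subAt 𝒯 p ≡ just C → WellFormed C
  subcluster-wellFormed 𝒯 [] wf refl = wf
  subcluster-wellFormed (leaf _ _ _) (_ ∷ _) _ ()
  subcluster-wellFormed (merge m L R) (false ∷ p) (wfL , _) at = subcluster-wellFormed L p wfL at
  subcluster-wellFormed (merge m L R) (true ∷ p) (_ , wfR , _) at = subcluster-wellFormed R p wfR at

  leaf-below : ∀ (𝒯 : TopTree A) p p′ {C a b q} → WellFormed 𝒯 → subAt 𝒯 p ≡ just C →
    subAt 𝒯 p′ ≡ just (leaf a b q) → EdgeIn C q → p ≼ p′
  leaf-below 𝒯 [] p′ _ _ _ _ = p′ , refl
  leaf-below (leaf _ _ _) (_ ∷ _) p′ _ ()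
  leaf-below (merge m L R) (_ ∷ _) [] _ _ ()
  leaf-below (merge m L R) (false ∷ p) (false ∷ p′) (wfL , _) atC atq q∈C =
    let s , e = leaf-below L p p′ wfL atC atq q∈C in s , cong (false ∷_) e
  leaf-below (merge m L R) (true ∷ p) (true ∷ p′) (_ , wfR , _) atC atq q∈C =
    let s , e = leaf-below R p p′ wfR atC atq q∈C in s , cong (true ∷_) e
  leaf-below (merge m L R) (false ∷ p) (true ∷ p′) {q = q} (_ , _ , disjoint , _) atC atq q∈C =
    ⊥-elim (disjoint q (subcluster-edges L p atC q∈C) (subcluster-edges R p′ atq refl))
  leaf-below (merge m L R) (true ∷ p) (false ∷ p′) {q = q} (_ , _ , disjoint , _) atC atq q∈C =
    ⊥-elim (disjoint q (subcluster-edges L p′ atq refl) (subcluster-edges R p atC q∈C))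

  inside-or-escaping : ∀ (C : TopTree A) z → (∀ q → EdgeIn C q → z ⊏ q) ⊎ ∃[ q ] (EdgeIn C q × ¬ z ⊏ q)
  inside-or-escaping (leaf _ _ q) z with z ⊏? q
  ... | yes inside = inj₁ λ { _ refl → inside }
  ... | no outside = inj₂ (q , refl , outside)
  inside-or-escaping (merge m L R) z with inside-or-escaping L z | inside-or-escaping R z
  ... | inj₂ (q , q∈L , outside) | _ = inj₂ (q , inj₁ q∈L , outside)
  ... | inj₁ _ | inj₂ (q , q∈R , outside) = inj₂ (q , inj₂ q∈R , outside)
  ... | inj₁ insideL | inj₁ insideR = inj₁ λ { q (inj₁ e) → insideL q e ; q (inj₂ e) → insideR q e }

-- The invariant of the greedy construction, for a fixed tree T

module Greedy {A : Set} (T : Tree A) where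

  -- C is the cluster of an edge of T~ from (the node standing for) x down
  -- to y: its edges are edges of T below x, it is branch-closed at x,
  -- its lowest edge is y, and it is well formed
  record Hanging (x y : Pos) (C : TopTree A) : Set where
    field
      edges-exist   : ∀ q → EdgeIn C q → IsNode T q
      below         : Below x C
      branch-closed : BranchClosed x C
      has-bottom    : EdgeIn C y
      bottom-lowest : ∀ q → EdgeIn C q → ¬ y ⊏ q
      well-formed   : WellFormed C
  open Hanging

  leaf-hanging : ∀ {a b} x i → IsNode T (x ++ [ i ]) → Hanging x (x ++ [ i ]) (leaf a b (x ++ [ i ]))
  leaf-hanging x i exists = record
    { edges-exist   = λ { _ refl → exists }
    ; below         = λ { _ refl → i , [] , refl }
    ; branch-closed = λ { _ j s refl e → cong (λ k → x ++ [ k ]) (sym (branch-injective x e)) }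
    ; has-bottom    = refl
    ; bottom-lowest = λ { _ refl → ⊏-irrefl (x ++ [ i ]) }
    ; well-formed   = tt
    }

  vertical-merge : ∀ m {x y y₀ P Q} → Hanging x y P → Hanging y y₀ Q → EdgeIn Q (y ++ [ 0 ]) →
    Hanging x y₀ (merge m P Q)
  vertical-merge m {x} {y} {y₀} {P} {Q} hP hQ y₁∈Q = record
    { edges-exist   = λ { q (inj₁ e) → edges-exist hP q e ; q (inj₂ e) → edges-exist hQ q e }
    ; below         = λ { q (inj₁ e) → below hP q e
                        ; q (inj₂ e) → ⊏-trans (below hP y (has-bottom hP)) (below hQ q e) }
    ; branch-closed = closed
    ; has-bottom    = inj₂ (has-bottom hQ)
    ; bottom-lowest = λ { q (inj₁ e) y₀⊏q → bottom-lowest hP q e (⊏-trans (below hQ y₀ (has-bottom hQ)) y₀⊏q)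
                        ; q (inj₂ e) → bottom-lowest hQ q e }
    ; well-formed   = well-formed hP , well-formed hQ ,
                      (λ q e₁ e₂ → bottom-lowest hP q e₁ (below hQ q e₂)) ,
                      boundaryClosed-vertical m (has-bottom hP) (below hQ) (branch-closed hQ) y₁∈Q
                        (boundaryClosed P (well-formed hP)) (boundaryClosed Q (well-formed hQ))
    }
    where
    -- an edge of Q lies on the branch of x containing y, whose first edge is in P
    closed : BranchClosed x (merge m P Q)
    closed q i s (inj₁ e) eq = inj₁ (branch-closed hP q i s e eq)
    closed q i s (inj₂ e) eq =
      let j , t , y-on-j = below hP y (has-bottom hP)
          s′ , q-on-j = same-branch y-on-j (below hQ q e)
      in inj₁ (subst (λ k → EdgeIn P (x ++ [ k ])) (branch-injective x (trans q-on-j (sym eq)))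
                 (branch-closed hP y j t (has-bottom hP) y-on-j))

  horizontal-merge : ∀ m {x y₁ y₂ P Q} → Hanging x y₁ P → Hanging x y₂ Q → Disjoint P Q →
    Hanging x y₁ (merge m P Q) × Hanging x y₂ (merge m P Q)
  horizontal-merge m {x} {y₁} {y₂} {P} {Q} hP hQ disjoint =
    hanging y₁ (inj₁ (has-bottom hP)) lowest₁ , hanging y₂ (inj₂ (has-bottom hQ)) lowest₂
    where
    -- nothing of Q lies below y₁: it would share the branch of y₁ with P
    lowest₁ : ∀ q → EdgeIn (merge m P Q) q → ¬ y₁ ⊏ q
    lowest₁ q (inj₁ e) = bottom-lowest hP q e
    lowest₁ q (inj₂ e) y₁⊏q =
      let j , inP , inQ = shared-branch (below hP y₁ (has-bottom hP)) (branch-closed hP) (has-bottom hP)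
                            (branch-closed hQ) e y₁⊏q
      in disjoint _ inP inQ

    lowest₂ : ∀ q → EdgeIn (merge m P Q) q → ¬ y₂ ⊏ q
    lowest₂ q (inj₂ e) = bottom-lowest hQ q e
    lowest₂ q (inj₁ e) y₂⊏q =
      let j , inQ , inP = shared-branch (below hQ y₂ (has-bottom hQ)) (branch-closed hQ) (has-bottom hQ)
                            (branch-closed hP) e y₂⊏q
      in disjoint _ inP inQ

    hanging : ∀ y → EdgeIn (merge m P Q) y → (∀ q → EdgeIn (merge m P Q) q → ¬ y ⊏ q) →
      Hanging x y (merge m P Q)
    hanging y y∈PQ lowest = record
      { edges-exist   = λ { q (inj₁ e) → edges-exist hP q e ; q (inj₂ e) → edges-exist hQ q e }
      ; below         = λ { q (inj₁ e) → below hP q e ; q (inj₂ e) → below hQ q e }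
      ; branch-closed = λ { q i s (inj₁ e) eq → inj₁ (branch-closed hP q i s e eq)
                          ; q i s (inj₂ e) eq → inj₂ (branch-closed hQ q i s e eq) }
      ; has-bottom    = y∈PQ
      ; bottom-lowest = lowest
      ; well-formed   = well-formed hP , well-formed hQ , disjoint ,
                        boundaryClosed-horizontal m (below hP) (branch-closed hP) (below hQ) (branch-closed hQ)
                          (boundaryClosed P (well-formed hP)) (boundaryClosed Q (well-formed hQ))
      }

  KidEdge : Kids A → Pos → Set
  KidEdge none q = ⊥
  KidEdge (kid c _ _ ks) q = EdgeIn c q ⊎ KidEdge ks q

  mutual
    EdgeBelow : Aux A → Pos → Set
    EdgeBelow (anode ks) q = EdgeBelowKids ks q

    EdgeBelowKids : Kids A → Pos → Set
    EdgeBelowKids none q = ⊥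
    EdgeBelowKids (kid c _ t ks) q = EdgeIn c q ⊎ EdgeBelow t q ⊎ EdgeBelowKids ks q

  kidEdge-below : ∀ ks q → KidEdge ks q → EdgeBelowKids ks q
  kidEdge-below (kid c f t ks) q (inj₁ e) = inj₁ e
  kidEdge-below (kid c f t ks) q (inj₂ e) = inj₂ (inj₂ (kidEdge-below ks q e))

  DisjointFrom : TopTree A → Kids A → Set
  DisjointFrom c ks = ∀ q → EdgeIn c q → KidEdge ks q → ⊥

  FirstHas : Pos → Kids A → Set
  FirstHas w none = ⊤
  FirstHas w (kid c _ _ _) = EdgeIn c w

  -- the invariant of a node of T~ standing for the node p of T
  mutual
    NodeOK : Pos → Aux A → Set
    NodeOK p (anode ks) = KidsOK p ks × FirstHas (p ++ [ 0 ]) ks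

    KidOK : Pos → TopTree A → Aux A → Set
    KidOK p c t = Σ Pos λ y → Hanging p y c × NodeOK y t

    KidsOK : Pos → Kids A → Set
    KidsOK p none = ⊤
    KidsOK p (kid c _ t ks) = KidOK p c t × DisjointFrom c ks × KidsOK p ks

  mutual
    edgeBelow-below : ∀ p t q → NodeOK p t → EdgeBelow t q → p ⊏ q
    edgeBelow-below p (anode ks) q (ok , _) e = edgeBelowKids-below p ks q ok e

    edgeBelowKids-below : ∀ p ks q → KidsOK p ks → EdgeBelowKids ks q → p ⊏ q
    edgeBelowKids-below p (kid c f t ks) q ((y , h , _) , _) (inj₁ e) = below h q e
    edgeBelowKids-below p (kid c f t ks) q ((y , h , ok) , _) (inj₂ (inj₁ e)) =
      ⊏-trans (below h y (has-bottom h)) (edgeBelow-below y t q ok e)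
    edgeBelowKids-below p (kid c f t ks) q (_ , _ , ok) (inj₂ (inj₂ e)) = edgeBelowKids-below p ks q ok e

  kid-branch : ∀ p c t q → KidOK p c t → EdgeIn c q ⊎ EdgeBelow t q →
    ∃[ i ] ∃[ s ] (p ++ i ∷ s ≡ q × EdgeIn c (p ++ [ i ]))
  kid-branch p c t q (y , h , ok) (inj₁ e) with below h q e
  ... | i , s , eq = i , s , eq , branch-closed h q i s e eq
  kid-branch p c t q (y , h , ok) (inj₂ e) with below h y (has-bottom h)
  ... | i , s , eq with same-branch eq (edgeBelow-below y t q ok e)
  ...   | s′ , eq′ = i , s′ , eq′ , branch-closed h y i s (has-bottom h) eq

  kids-branch : ∀ p ks q → KidsOK p ks → EdgeBelowKids ks q →
    ∃[ i ] ∃[ s ] (p ++ i ∷ s ≡ q × KidEdge ks (p ++ [ i ]))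
  kids-branch p (kid c f t ks) q (ok , _) (inj₁ e) =
    let i , s , eq , first = kid-branch p c t q ok (inj₁ e) in i , s , eq , inj₁ first
  kids-branch p (kid c f t ks) q (ok , _) (inj₂ (inj₁ e)) =
    let i , s , eq , first = kid-branch p c t q ok (inj₂ e) in i , s , eq , inj₁ first
  kids-branch p (kid c f t ks) q (_ , _ , ok) (inj₂ (inj₂ e)) =
    let i , s , eq , first = kids-branch p ks q ok e in i , s , eq , inj₂ first

  -- Disjointness survives regrouping: a cluster made of the edges of one
  -- T~ edge and everything below it is disjoint from clusters made of
  -- edges of its right siblings and below, since they use other branches.
  disjoint-regrouped : ∀ {p c t ks} d rest → KidOK p c t → DisjointFrom c ks → KidsOK p ks →
    (∀ q → EdgeIn d q → EdgeIn c q ⊎ EdgeBelow t q) → (∀ q → KidEdge rest q → EdgeBelowKids ks q) →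
    DisjointFrom d rest
  disjoint-regrouped {p} {c} {t} {ks} d rest ok disjoint oks d⊆ rest⊆ q q∈d q∈rest =
    let i , _ , eq , first = kid-branch p c t q ok (d⊆ q q∈d)
        i′ , _ , eq′ , first′ = kids-branch p ks q oks (rest⊆ q q∈rest)
    in disjoint _ first (subst (λ k → KidEdge ks (p ++ [ k ])) (branch-injective p (trans eq′ (sym eq))) first′)

  -- Initialisation: T~ = T, every edge its own leaf cluster

  Embedded : Pos → Tree A → Set
  Embedded p t = ∀ s u → subtreeAt t s ≡ just u → IsNode T (p ++ s)

  EmbeddedFrom : Pos → ℕ → List (Tree A) → Set
  EmbeddedFrom p i ts = ∀ j s u → subtreeAtList ts j s ≡ just u → IsNode T (p ++ (i + j) ∷ s)

  toKids-edge : ∀ p l k ts q → KidEdge (toKids p l k ts) q → ∃[ j ] (p ++ [ k + j ] ≡ q)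
  toKids-edge p l k (t ∷ ts) q (inj₁ e) = 0 , trans (cong (λ m → p ++ [ m ]) (+-identityʳ k)) e
  toKids-edge p l k (t ∷ ts) q (inj₂ e) =
    let j , eq = toKids-edge p l (suc k) ts q e
    in suc j , trans (cong (λ m → p ++ [ m ]) (+-suc k j)) eq

  toKids-first : ∀ p l ts → FirstHas (p ++ [ 0 ]) (toKids p l 0 ts)
  toKids-first p l [] = tt
  toKids-first p l (t ∷ ts) = refl

  mutual
    toAux-ok : ∀ p t → Embedded p t → NodeOK p (toAux p t)
    toAux-ok p (node l ts) emb = toKids-ok p l 0 ts (λ j s u e → emb (j ∷ s) u e) , toKids-first p l ts

    toKids-ok : ∀ p l i ts → EmbeddedFrom p i ts → KidsOK p (toKids p l i ts)
    toKids-ok p l i [] _ = tt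
    toKids-ok p l i (t ∷ ts) emb =
      (p ++ [ i ] , leaf-hanging p i child , toAux-ok (p ++ [ i ]) t emb-t) , disjoint ,
      toKids-ok p l (suc i) ts emb-ts
      where
      child : IsNode T (p ++ [ i ])
      child = subst (λ k → IsNode T (p ++ [ k ])) (+-identityʳ i) (emb 0 [] t refl)
      emb-t : Embedded (p ++ [ i ]) t
      emb-t s u e = subst (IsNode T)
        (trans (cong (λ k → p ++ k ∷ s) (+-identityʳ i)) (sym (++-assoc p [ i ] s))) (emb 0 s u e)
      emb-ts : EmbeddedFrom p (suc i) ts
      emb-ts j s u e = subst (λ k → IsNode T (p ++ k ∷ s)) (+-suc i j) (emb (suc j) s u e)
      disjoint : DisjointFrom (leaf l (label t) (p ++ [ i ])) (toKids p l (suc i) ts)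
      disjoint q refl e = let j , eq = toKids-edge p l (suc i) ts q e in m≢1+m+n i (branch-injective p (sym eq))

  -- Step 1.  pairUp regroups a list of sibling edges: each edge is kept
  -- or fused with its right neighbour, the fused edge leading to one of
  -- the two subtrees.

  data Regroup : Kids A → Kids A → Set where
    done   : Regroup none none
    keep   : ∀ {c f t ks ks′} → Regroup ks ks′ → Regroup (kid c f t ks) (kid c false t ks′)
    fuseˡ  : ∀ m {c₁ f₁ t₁ c₂ f₂ t₂ ks ks′} → Regroup ks ks′ →
             Regroup (kid c₁ f₁ t₁ (kid c₂ f₂ t₂ ks)) (kid (merge m c₁ c₂) true t₁ ks′)
    fuseʳ  : ∀ m {c₁ f₁ t₁ c₂ f₂ t₂ ks ks′} → Regroup ks ks′ →
             Regroup (kid c₁ f₁ t₁ (kid c₂ f₂ t₂ ks)) (kid (merge m c₁ c₂) true t₂ ks′)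

  hmerge-regroup : ∀ {c₁ f₁ t₁ c₂ f₂ t₂ ks ks′} → Regroup ks ks′ →
    Regroup (kid c₁ f₁ t₁ (kid c₂ f₂ t₂ ks)) (hmerge c₁ t₁ c₂ t₂ ks′)
  hmerge-regroup {t₁ = t₁} {t₂ = t₂} r with isLeaf t₁ | isLeaf t₂
  ... | false | false = keep (keep r)
  ... | false | true  = fuseˡ typeC r
  ... | true  | false = fuseʳ typeD r
  ... | true  | true  = fuseˡ typeE r

  pairUp-regroup : ∀ ks → Regroup ks (pairUp ks)
  pairUp-regroup none = done
  pairUp-regroup (kid c f t none) = keep done
  pairUp-regroup (kid c₁ f₁ t₁ (kid c₂ f₂ t₂ none)) = hmerge-regroup done
  pairUp-regroup (kid c₁ f₁ t₁ (kid c₂ f₂ t₂ (kid c₃ f₃ t₃ none))) with isLeaf t₁ | isLeaf t₂ | isLeaf t₃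
  ... | false | false | true  = keep (hmerge-regroup done)
  ... | false | false | false = keep (keep (keep done))
  ... | true  | _     | _     = hmerge-regroup (keep done)
  ... | false | true  | _     = hmerge-regroup (keep done)
  pairUp-regroup (kid c₁ f₁ t₁ (kid c₂ f₂ t₂ rest@(kid _ _ _ (kid _ _ _ _)))) =
    hmerge-regroup (pairUp-regroup rest)

  regroup-edges : ∀ {ks ks′} → Regroup ks ks′ → ∀ q → KidEdge ks′ q → KidEdge ks q
  regroup-edges (keep r) q (inj₁ e) = inj₁ e
  regroup-edges (keep r) q (inj₂ e) = inj₂ (regroup-edges r q e)
  regroup-edges (fuseˡ m r) q (inj₁ (inj₁ e)) = inj₁ e
  regroup-edges (fuseˡ m r) q (inj₁ (inj₂ e)) = inj₂ (inj₁ e)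
  regroup-edges (fuseˡ m r) q (inj₂ e) = inj₂ (inj₂ (regroup-edges r q e))
  regroup-edges (fuseʳ m r) q (inj₁ (inj₁ e)) = inj₁ e
  regroup-edges (fuseʳ m r) q (inj₁ (inj₂ e)) = inj₂ (inj₁ e)
  regroup-edges (fuseʳ m r) q (inj₂ e) = inj₂ (inj₂ (regroup-edges r q e))

  regroup-first : ∀ {w ks ks′} → Regroup ks ks′ → FirstHas w ks → FirstHas w ks′
  regroup-first done _ = tt
  regroup-first (keep r) w∈c = w∈c
  regroup-first (fuseˡ m r) w∈c = inj₁ w∈c
  regroup-first (fuseʳ m r) w∈c = inj₁ w∈c

  fused-disjoint : ∀ m {c₁ c₂ ks ks′} → Regroup ks ks′ → (∀ q → EdgeIn c₁ q → EdgeIn c₂ q ⊎ KidEdge ks q → ⊥) →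
    DisjointFrom c₂ ks → DisjointFrom (merge m c₁ c₂) ks′
  fused-disjoint m r d₁ d₂ q (inj₁ e) e′ = d₁ q e (inj₂ (regroup-edges r q e′))
  fused-disjoint m r d₁ d₂ q (inj₂ e) e′ = d₂ q e (regroup-edges r q e′)

  regroup-ok : ∀ {p ks ks′} → Regroup ks ks′ → KidsOK p ks → KidsOK p ks′
  regroup-ok done _ = tt
  regroup-ok (keep r) (ok , disjoint , oks) =
    ok , (λ q e e′ → disjoint q e (regroup-edges r q e′)) , regroup-ok r oks
  regroup-ok (fuseˡ m r) ((y₁ , h₁ , ok₁) , disjoint₁ , (y₂ , h₂ , ok₂) , disjoint₂ , oks) =
    (y₁ , proj₁ (horizontal-merge m h₁ h₂ (λ q e₁ e₂ → disjoint₁ q e₁ (inj₁ e₂))) , ok₁) ,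
    fused-disjoint m r disjoint₁ disjoint₂ , regroup-ok r oks
  regroup-ok (fuseʳ m r) ((y₁ , h₁ , ok₁) , disjoint₁ , (y₂ , h₂ , ok₂) , disjoint₂ , oks) =
    (y₂ , proj₂ (horizontal-merge m h₁ h₂ (λ q e₁ e₂ → disjoint₁ q e₁ (inj₁ e₂))) , ok₂) ,
    fused-disjoint m r disjoint₁ disjoint₂ , regroup-ok r oks

  step1Kids-first : ∀ {w} ks → FirstHas w ks → FirstHas w (step1Kids ks)
  step1Kids-first none _ = tt
  step1Kids-first (kid c f t ks) w∈c = w∈c

  mutual
    step1-ok : ∀ p t → NodeOK p t → NodeOK p (step1 t)
    step1-ok p (anode ks) (ok , first) =
      regroup-ok regroup (step1Kids-ok p ks ok) , regroup-first regroup (step1Kids-first ks first)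
      where regroup = pairUp-regroup (step1Kids ks)

    step1Kids-ok : ∀ p ks → KidsOK p ks → KidsOK p (step1Kids ks)
    step1Kids-ok p none _ = tt
    step1Kids-ok p (kid c f t ks) ((y , h , ok) , disjoint , oks) =
      (y , h , step1-ok y t ok) , (λ q e e′ → disjoint q e (step1Kids-edges ks q e′)) , step1Kids-ok p ks oks

    step1Kids-edges : ∀ ks q → KidEdge (step1Kids ks) q → KidEdge ks q
    step1Kids-edges (kid c f t ks) q (inj₁ e) = inj₁ e
    step1Kids-edges (kid c f t ks) q (inj₂ e) = inj₂ (step1Kids-edges ks q e)

  -- Step 2.  One unfolding of step2Kids and of down on a single edge.

  step2Head : TopTree A → Bool → DownRes A → Kids A → Kids A
  step2Head c f (even t′) rest = kid c false t′ rest
  step2Head c false (odd c₀ b t′) rest = kid (merge (vtype b) c c₀) false t′ rest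
  step2Head c true (odd c₀ b t′) rest = kid c false (anode (kid c₀ false t′ none)) rest

  step2Kids-unfold : ∀ c f t ks → step2Kids (kid c f t ks) ≡ step2Head c f (down t) (step2Kids ks)
  step2Kids-unfold c false t ks with down t
  ... | even _ = refl
  ... | odd _ _ _ = refl
  step2Kids-unfold c true t ks with down t
  ... | even _ = refl
  ... | odd _ _ _ = refl

  downHead : TopTree A → Aux A → DownRes A → DownRes A
  downHead c t (even t′) = odd c (isLeaf t) t′
  downHead c t (odd c₀ b t′) = even (anode (kid (merge (vtype b) c c₀) false t′ none))

  down-unfold : ∀ c f t → down (anode (kid c f t none)) ≡ downHead c t (down t)
  down-unfold c f t with down t
  ... | even _ = refl
  ... | odd _ _ _ = refl

  EdgeInDown : DownRes A → Pos → Set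
  EdgeInDown (even t) q = EdgeBelow t q
  EdgeInDown (odd c b t) q = EdgeIn c q ⊎ EdgeBelow t q

  DownOK : Pos → DownRes A → Set
  DownOK y (even t) = NodeOK y t
  DownOK y (odd c₀ b t) = Σ Pos λ y₀ → Hanging y y₀ c₀ × NodeOK y₀ t × EdgeIn c₀ (y ++ [ 0 ])

  step2Head-edges : ∀ {c t ks} f d rest → (∀ q → EdgeInDown d q → EdgeBelow t q) →
    (∀ q → EdgeBelowKids rest q → EdgeBelowKids ks q) →
    ∀ q → EdgeBelowKids (step2Head c f d rest) q → EdgeBelowKids (kid c f t ks) q
  step2Head-edges f (even t′) rest d⊆ rest⊆ q (inj₁ e) = inj₁ e
  step2Head-edges f (even t′) rest d⊆ rest⊆ q (inj₂ (inj₁ e)) = inj₂ (inj₁ (d⊆ q e))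
  step2Head-edges false (odd c₀ b t′) rest d⊆ rest⊆ q (inj₁ (inj₁ e)) = inj₁ e
  step2Head-edges false (odd c₀ b t′) rest d⊆ rest⊆ q (inj₁ (inj₂ e)) = inj₂ (inj₁ (d⊆ q (inj₁ e)))
  step2Head-edges false (odd c₀ b t′) rest d⊆ rest⊆ q (inj₂ (inj₁ e)) = inj₂ (inj₁ (d⊆ q (inj₂ e)))
  step2Head-edges true (odd c₀ b t′) rest d⊆ rest⊆ q (inj₁ e) = inj₁ e
  step2Head-edges true (odd c₀ b t′) rest d⊆ rest⊆ q (inj₂ (inj₁ (inj₁ e))) = inj₂ (inj₁ (d⊆ q (inj₁ e)))
  step2Head-edges true (odd c₀ b t′) rest d⊆ rest⊆ q (inj₂ (inj₁ (inj₂ (inj₁ e)))) =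
    inj₂ (inj₁ (d⊆ q (inj₂ e)))
  step2Head-edges f (even t′) rest d⊆ rest⊆ q (inj₂ (inj₂ e)) = inj₂ (inj₂ (rest⊆ q e))
  step2Head-edges false (odd c₀ b t′) rest d⊆ rest⊆ q (inj₂ (inj₂ e)) = inj₂ (inj₂ (rest⊆ q e))
  step2Head-edges true (odd c₀ b t′) rest d⊆ rest⊆ q (inj₂ (inj₁ (inj₂ (inj₂ ()))))
  step2Head-edges true (odd c₀ b t′) rest d⊆ rest⊆ q (inj₂ (inj₂ e)) = inj₂ (inj₂ (rest⊆ q e))

  downHead-edges : ∀ {f} c t d → (∀ q → EdgeInDown d q → EdgeBelow t q) →
    ∀ q → EdgeInDown (downHead c t d) q → EdgeBelow (anode (kid c f t none)) q
  downHead-edges c t (even t′) d⊆ q (inj₁ e) = inj₁ e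
  downHead-edges c t (even t′) d⊆ q (inj₂ e) = inj₂ (inj₁ (d⊆ q e))
  downHead-edges c t (odd c₀ b t′) d⊆ q (inj₁ (inj₁ e)) = inj₁ e
  downHead-edges c t (odd c₀ b t′) d⊆ q (inj₁ (inj₂ e)) = inj₂ (inj₁ (d⊆ q (inj₁ e)))
  downHead-edges c t (odd c₀ b t′) d⊆ q (inj₂ (inj₁ e)) = inj₂ (inj₁ (d⊆ q (inj₂ e)))

  mutual
    step2-edges : ∀ t q → EdgeBelow (step2 t) q → EdgeBelow t q
    step2-edges (anode ks) = step2Kids-edges ks

    step2Kids-edges : ∀ ks q → EdgeBelowKids (step2Kids ks) q → EdgeBelowKids ks q
    step2Kids-edges none q ()
    step2Kids-edges (kid c f t ks) q e =
      step2Head-edges {t = t} f (down t) (step2Kids ks) (down-edges t) (step2Kids-edges ks) q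
        (subst (λ k → EdgeBelowKids k q) (step2Kids-unfold c f t ks) e)

    down-edges : ∀ t q → EdgeInDown (down t) q → EdgeBelow t q
    down-edges (anode none) q ()
    down-edges (anode (kid c f t none)) q e =
      downHead-edges {f} c t (down t) (down-edges t) q (subst (λ d → EdgeInDown d q) (down-unfold c f t) e)
    down-edges x@(anode (kid _ _ _ (kid _ _ _ _))) = step2-edges x

  step2Head-ok : ∀ {p y c t ks} f d rest → Hanging p y c → NodeOK y t → DisjointFrom c ks → KidsOK p ks →
    DownOK y d → (∀ q → EdgeInDown d q → EdgeBelow t q) →
    KidsOK p rest → (∀ q → KidEdge rest q → EdgeBelowKids ks q) → KidsOK p (step2Head c f d rest)
  step2Head-ok {c = c} {t = t} f (even t′) rest h ok disjoint oks ok′ d⊆ oks′ rest⊆ =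
    (_ , h , ok′) , disjoint-regrouped {t = t} c rest (_ , h , ok) disjoint oks (λ q e → inj₁ e) rest⊆ , oks′
  step2Head-ok {c = c} {t = t} false (odd c₀ b t′) rest h ok disjoint oks (y₀ , h₀ , ok₀ , first₀) d⊆ oks′ rest⊆ =
    (y₀ , vertical-merge (vtype b) h h₀ first₀ , ok₀) ,
    disjoint-regrouped {t = t} (merge (vtype b) c c₀) rest (_ , h , ok) disjoint oks
      (λ { q (inj₁ e) → inj₁ e ; q (inj₂ e) → inj₂ (d⊆ q (inj₁ e)) }) rest⊆ ,
    oks′
  step2Head-ok {c = c} {t = t} true (odd c₀ b t′) rest h ok disjoint oks (y₀ , h₀ , ok₀ , first₀) d⊆ oks′ rest⊆ =
    (_ , h , ((y₀ , h₀ , ok₀) , (λ _ _ ()) , tt) , first₀) ,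
    disjoint-regrouped {t = t} c rest (_ , h , ok) disjoint oks (λ q e → inj₁ e) rest⊆ , oks′

  step2Head-first : ∀ {w c} f d rest → EdgeIn c w → FirstHas w (step2Head c f d rest)
  step2Head-first f (even _) rest w∈c = w∈c
  step2Head-first false (odd _ _ _) rest w∈c = inj₁ w∈c
  step2Head-first true (odd _ _ _) rest w∈c = w∈c

  step2Kids-first : ∀ {w} ks → FirstHas w ks → FirstHas w (step2Kids ks)
  step2Kids-first none _ = tt
  step2Kids-first {w} (kid c f t ks) w∈c =
    subst (FirstHas w) (sym (step2Kids-unfold c f t ks)) (step2Head-first f (down t) (step2Kids ks) w∈c)

  downHead-ok : ∀ {y y₀ c} t d → Hanging y y₀ c → EdgeIn c (y ++ [ 0 ]) → DownOK y₀ d →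
    DownOK y (downHead c t d)
  downHead-ok t (even t′) h first ok′ = _ , h , ok′ , first
  downHead-ok t (odd c₀ b t′) h first (y₁ , h₀ , ok₁ , first₀) =
    ((y₁ , vertical-merge (vtype b) h h₀ first₀ , ok₁) , (λ _ _ ()) , tt) , inj₁ first

  mutual
    step2-ok : ∀ p t → NodeOK p t → NodeOK p (step2 t)
    step2-ok p (anode ks) (ok , first) = step2Kids-ok p ks ok , step2Kids-first ks first

    step2Kids-ok : ∀ p ks → KidsOK p ks → KidsOK p (step2Kids ks)
    step2Kids-ok p none _ = tt
    step2Kids-ok p (kid c f t ks) ((y , h , ok) , disjoint , oks) =
      subst (KidsOK p) (sym (step2Kids-unfold c f t ks))
        (step2Head-ok {t = t} {ks = ks} f (down t) (step2Kids ks) h ok disjoint oks (down-ok y t ok)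
          (down-edges t) (step2Kids-ok p ks oks) (λ q e → step2Kids-edges ks q (kidEdge-below _ q e)))

    down-ok : ∀ y t → NodeOK y t → DownOK y (down t)
    down-ok y (anode none) _ = tt , tt
    down-ok y (anode (kid c f t none)) (((y₀ , h , ok) , _ , _) , first) =
      subst (DownOK y) (sym (down-unfold c f t)) (downHead-ok t (down t) h first (down-ok y₀ t ok))
    down-ok y x@(anode (kid _ _ _ (kid _ _ _ _))) ok = step2-ok y x ok

  iteration-ok : ∀ x → NodeOK [] x → NodeOK [] (step2 (step1 x))
  iteration-ok x ok = step2-ok [] (step1 x) (step1-ok [] x ok)

  Result : TopTree A → Set
  Result 𝒯 = WellFormed 𝒯 × (∀ q → EdgeIn 𝒯 q → IsNode T q)

  -- the single remaining T~ edge carries the whole top tree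
  loop-result : ∀ n x {𝒯} → NodeOK [] x → loop n x ≡ just 𝒯 → Result 𝒯
  loop-result n (anode (kid c f (anode none) none)) (((_ , h , _) , _) , _) refl = well-formed h , edges-exist h
  loop-result zero (anode none) _ ()
  loop-result zero (anode (kid c f (anode (kid _ _ _ _)) none)) _ ()
  loop-result zero (anode (kid c f (anode none) (kid _ _ _ _))) _ ()
  loop-result zero (anode (kid c f (anode (kid _ _ _ _)) (kid _ _ _ _))) _ ()
  loop-result (suc n) x@(anode none) ok = loop-result n _ (iteration-ok x ok)
  loop-result (suc n) x@(anode (kid c f (anode (kid _ _ _ _)) none)) ok = loop-result n _ (iteration-ok x ok)
  loop-result (suc n) x@(anode (kid c f (anode none) (kid _ _ _ _))) ok = loop-result n _ (iteration-ok x ok)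
  loop-result (suc n) x@(anode (kid c f (anode (kid _ _ _ _)) (kid _ _ _ _))) ok =
    loop-result n _ (iteration-ok x ok)

  greedy-result : ∀ {fuel 𝒯} → greedy fuel T ≡ just 𝒯 → Result 𝒯
  greedy-result {fuel} = loop-result fuel (toAux [] T) (toAux-ok [] T (λ s u e → u , e))

lemma3 : {A : Set} (T : Tree A) (fuel : ℕ) (𝒯 : TopTree A) → greedy fuel T ≡ just 𝒯 →
    (z : Pos) → IsNode T z → IsNode T (z ++ [ 0 ]) →
    (l : TPos) → LeafFor 𝒯 l (z ++ [ 0 ]) →
    (u : TPos) (U : TopTree A) → subAt 𝒯 u ≡ just U → SmallestContaining T 𝒯 z U →
    (c : TPos) (C : TopTree A) → subAt 𝒯 c ≡ just C → OffPath u l c →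
    EdgesInside T z C ⊎ EdgesDisjoint T z C
lemma3 T fuel 𝒯 built z _ _ l (a , b , atLeaf) u U _ _ c C atC ((c′ , d , c≡ , (r , u≼c′) , _) , offPath)
  with Greedy.greedy-result T built | inside-or-escaping C z
... | _ , exist | inj₁ inside = inj₁ λ q e → exist q (subcluster-edges 𝒯 c atC e) , inside q e
... | wf , _ | inj₂ (q₂ , e₂ , outside) = inj₂ λ q e _ inside →
  misses-leaf (boundaryClosed C (subcluster-wellFormed 𝒯 c wf atC) z q q₂ e e₂ inside outside)
  where
  u≼c : u ≼ c
  u≼c = r ++ [ d ] , trans (sym (++-assoc u r [ d ])) (trans (cong (_++ [ d ]) u≼c′) (sym c≡))

  -- a cluster containing (z, z₁) is an ancestor of L_z, hence on the path
  misses-leaf : ¬ EdgeIn C (z ++ [ 0 ])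
  misses-leaf e = offPath (u≼c , leaf-below 𝒯 c l wf atC atLeaf e)
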